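{- Let $G$ be a finite abelian group. Then $OD(G)$ is a star graph if and only if $G$ is elementary abelian.
   Context: For a finite group $G$, the order divisor graph $OD(G)$ is the simple undirected graph with vertex set $G$ in which two distinct vertices $a,b$ are adjacent if and only if $o(a)\neq o(b)$ and either $o(a)\mid o(b)$ or $o(b)\mid o(a)$. A star graph is a tree having one vertex adjacent to all other vertices, all other vertices having degree $1$. An elementary abelian group is an abelian $p$-group of exponent $p$ for some prime $p$, i.e. a group isomorphic to $\mathbb{Z}_p^n$. -}

module Defs where

open import Level using (Level; _⊔_)
open import Algebra.Bundles using (AbelianGroup)
open import Data.Nat using (ℕ; zero; suc; _<_; _≤_)
open import Data.Nat.Divisibility using (_∣_)
open import Data.Nat.Primality using (Prime)
open import Data.Fin using (Fin)
open import Data.Product using (Σ; ∃; _×_)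
open import Data.Sum using (_⊎_)
open import Relation.Nullary using (¬_)
open import Relation.Binary.PropositionalEquality using (_≡_; _≢_)

module _ {c ℓ : Level} (G : AbelianGroup c ℓ) where
  open AbelianGroup G

  pow : Carrier → ℕ → Carrier
  pow x zero    = ε
  pow x (suc k) = x ∙ pow x k

  IsOrder : Carrier → ℕ → Set ℓ
  IsOrder x k = (1 ≤ k) × (pow x k ≈ ε) × (∀ j → 1 ≤ j → j < k → ¬ (pow x j ≈ ε))

  record Finite : Set (c ⊔ ℓ) where
    field
      size     : ℕ
      to       : Carrier → Fin size
      from     : Fin size → Carrier
      to-cong  : ∀ {x y} → x ≈ y → to x ≡ to y
      from-to  : ∀ x → from (to x) ≈ x
      to-from  : ∀ i → to (from i) ≡ i

  ODAdj : Carrier → Carrier → Set ℓ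
  ODAdj a b = ¬ (a ≈ b) × Σ ℕ λ m → Σ ℕ λ n →
      IsOrder a m × IsOrder b n × m ≢ n × (m ∣ n ⊎ n ∣ m)

  -- OD(G) is a star: some centre is adjacent to every other vertex, and every
  -- other vertex has degree 1, i.e. every edge is incident to the centre
  ODIsStar : Set (c ⊔ ℓ)
  ODIsStar = Σ Carrier λ z →
      (∀ v → ¬ (v ≈ z) → ODAdj z v) ×
      (∀ u v → ODAdj u v → (u ≈ z) ⊎ (v ≈ z))

  -- elementary abelian: (abelian) group of exponent a prime p, i.e. ≅ ℤ_p^n
  IsElementaryAbelian : Set (c ⊔ ℓ)
  IsElementaryAbelian = Σ ℕ λ p → Prime p × (∀ x → pow x p ≈ ε)

-- The identity is adjacent to every other vertex of OD(G), so OD(G) is a star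
-- exactly when no two non-identity elements are adjacent (if the centre is not
-- the identity, G has a single non-identity element).  Then every non-identity
-- x has prime order: for a proper divisor d of o(x) = q d, the power x^q has
-- order d and would be adjacent to x.  Two such primes p = o(x), q = o(y)
-- coincide: r = o(xy) is 1 or prime, and (xy)^k = x^k whenever q ∣ k gives
-- p ∣ r q, symmetrically q ∣ r p.  Hence G has prime exponent p.  Conversely,
-- in exponent p all non-identity elements have the same order p.
module Submission where

open import Defs
open import Level using (Level; _⊔_)
open import Algebra.Bundles using (AbelianGroup)
open import Function using (_∘_)
open import Function.Bundles using (_⇔_; mk⇔)
open import Data.Nat using (ℕ; zero; suc; _+_; _*_; _∸_; _<_; _≤_; _≤?_; z≤n; s≤s; _%_; _/_;
                           nonTrivial⇒n>1; n>1⇒nonTrivial)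
open import Data.Nat.Properties
  using (*-comm; ≤-trans; m≤m+n; m<n⇒0<n∸m; m∸n+n≡m; <⇒≤; <-irrefl; n<1+n; *-monoʳ-<; anyUpTo?)
open import Data.Nat.Induction using (<-rec)
open import Data.Nat.DivMod using (m≡m%n+[m/n]*n; m%n<n)
open import Data.Nat.Divisibility using (_∣_; divides; m%n≡0⇒n∣m; ∣-refl; ∣-antisym; 1∣_; ∣1⇒≡1; n∣m*n)
open import Data.Nat.Primality
  using (Prime; prime; Composite; prime⇒irreducible; ¬prime[1]; prime[2]; euclidsLemma)
open import Data.Nat.Divisibility.Core using (hasNonTrivialDivisor)
open import Data.Fin using (toℕ)
open import Data.Fin.Properties using (pigeonhole; all?; ¬∀⟶∃¬) renaming (_≟_ to _≟ᶠ_)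
open import Data.Product using (∃; _×_; _,_; proj₁; proj₂)
open import Data.Sum using (_⊎_; inj₁; inj₂)
open import Data.Empty using (⊥-elim)
open import Relation.Nullary using (¬_; Dec; yes; no)
open import Relation.Nullary.Decidable using (map′; _×-dec_)
open import Relation.Unary using (Pred; Decidable)
import Relation.Binary.PropositionalEquality as ≡
open ≡ using (_≡_)

least-witness : ∀ {p} {P : Pred ℕ p} → Decidable P → ∀ {k} → P k →
                ∃ λ n → P n × (∀ {j} → j < n → ¬ P j)
least-witness {P = P} P? = <-rec (λ k → P k → Least) descend _
  where
    Least = ∃ λ n → P n × (∀ {j} → j < n → ¬ P j)
    descend : ∀ k → (∀ {j} → j < k → P j → Least) → P k → Least
    descend k smaller Pk with anyUpTo? P? k
    ... | yes (j , j<k , Pj) = smaller j<k Pj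
    ... | no none            = k , Pk , λ j<k Pj → none (_ , j<k , Pj)

prime∣prime⇒≡ : ∀ {p q} → Prime p → Prime q → p ∣ q → p ≡ q
prime∣prime⇒≡ pp pq p∣q with prime⇒irreducible pq p∣q
... | inj₁ ≡.refl = ⊥-elim (¬prime[1] pp)
... | inj₂ p≡q    = p≡q

p∣r*q∧q∣r*p⇒p≡q : ∀ {p q r} → Prime p → Prime q → r ≡ 1 ⊎ Prime r →
                   p ∣ r * q → q ∣ r * p → p ≡ q
p∣r*q∧q∣r*p⇒p≡q {p} {q} {r} pp pq r-cases p∣r*q q∣r*p
  with euclidsLemma r q pp p∣r*q | euclidsLemma r p pq q∣r*p
... | inj₂ p∣q | _        = prime∣prime⇒≡ pp pq p∣q
... | _        | inj₂ q∣p = ≡.sym (prime∣prime⇒≡ pq pp q∣p)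
... | inj₁ p∣r | inj₁ q∣r with r-cases
...   | inj₁ ≡.refl = ⊥-elim (¬prime[1] (≡.subst Prime (∣1⇒≡1 p∣r) pp))
...   | inj₂ pr     = ≡.trans (prime∣prime⇒≡ pp pr p∣r) (≡.sym (prime∣prime⇒≡ pq pr q∣r))

module _ {c ℓ : Level} (G : AbelianGroup c ℓ) where
  open AbelianGroup G
  open import Algebra.Properties.Group group using (identityˡ-unique)
  open import Algebra.Properties.CommutativeMonoid.Mult commutativeMonoid
    renaming (_×_ to _·_) using (×-congʳ; ×-homo-+; ×-assocˡ; ×-distrib-+)
  open import Relation.Binary.Reasoning.Setoid setoid

  private
    infixr 8 _^_
    _^_ : Carrier → ℕ → Carrier
    _^_ = pow G

  -- pow is the library's monoid multiplication _·_ in disguise; the power laws come from there.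
  ^≈· : ∀ x n → x ^ n ≈ n · x
  ^≈· x zero    = refl
  ^≈· x (suc n) = ∙-congˡ (^≈· x n)

  ^-congˡ : ∀ {x y} n → x ≈ y → x ^ n ≈ y ^ n
  ^-congˡ {x} {y} n x≈y = trans (^≈· x n) (trans (×-congʳ n x≈y) (sym (^≈· y n)))

  ^-homo-+ : ∀ x m n → x ^ (m + n) ≈ x ^ m ∙ x ^ n
  ^-homo-+ x m n = trans (^≈· x (m + n)) (trans (×-homo-+ x m n) (sym (∙-cong (^≈· x m) (^≈· x n))))

  ^-assoc : ∀ x m n → (x ^ m) ^ n ≈ x ^ (m * n)
  ^-assoc x m n = begin
    (x ^ m) ^ n   ≈⟨ ^≈· (x ^ m) n ⟩
    n · (x ^ m)   ≈⟨ ×-congʳ n (^≈· x m) ⟩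
    n · (m · x)   ≈⟨ ×-assocˡ x n m ⟩
    (n * m) · x   ≡⟨ ≡.cong (_· x) (*-comm n m) ⟩
    (m * n) · x   ≈⟨ ^≈· x (m * n) ⟨
    x ^ (m * n)   ∎

  ^-distrib-∙ : ∀ x y n → (x ∙ y) ^ n ≈ x ^ n ∙ y ^ n
  ^-distrib-∙ x y n = trans (^≈· _ n) (trans (×-distrib-+ x y n) (sym (∙-cong (^≈· x n) (^≈· y n))))

  ε^n≈ε : ∀ n → ε ^ n ≈ ε
  ε^n≈ε zero    = refl
  ε^n≈ε (suc n) = trans (∙-congˡ (ε^n≈ε n)) (identityˡ ε)

  IsOrder-∣⇒^≈ε : ∀ {x n k} → IsOrder G x n → n ∣ k → x ^ k ≈ ε
  IsOrder-∣⇒^≈ε {x} {n} (_ , xⁿ≈ε , _) (divides q ≡.refl) = begin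
    x ^ (q * n)   ≡⟨ ≡.cong (x ^_) (*-comm q n) ⟩
    x ^ (n * q)   ≈⟨ ^-assoc x n q ⟨
    (x ^ n) ^ q   ≈⟨ ^-congˡ q xⁿ≈ε ⟩
    ε ^ q         ≈⟨ ε^n≈ε q ⟩
    ε             ∎

  IsOrder-least : ∀ {x n r} → IsOrder G x n → r < n → x ^ r ≈ ε → r ≡ 0
  IsOrder-least {r = zero}  _              _   _    = ≡.refl
  IsOrder-least {r = suc r} (_ , _ , least) r<n xʳ≈ε = ⊥-elim (least (suc r) (s≤s z≤n) r<n xʳ≈ε)

  IsOrder-^≈ε⇒∣ : ∀ {x n k} → IsOrder G x n → x ^ k ≈ ε → n ∣ k
  IsOrder-^≈ε⇒∣ {x} {n@(suc _)} {k} o xᵏ≈ε =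
    m%n≡0⇒n∣m k n (IsOrder-least o (m%n<n k n) x^[k%n]≈ε)
    where
      x^[k%n]≈ε : x ^ (k % n) ≈ ε
      x^[k%n]≈ε = begin
        x ^ (k % n)                      ≈⟨ identityʳ _ ⟨
        x ^ (k % n) ∙ ε                  ≈⟨ ∙-congˡ (IsOrder-∣⇒^≈ε o (n∣m*n (k / n))) ⟨
        x ^ (k % n) ∙ x ^ (k / n * n)    ≈⟨ ^-homo-+ x (k % n) (k / n * n) ⟨
        x ^ (k % n + k / n * n) ≡⟨ ≡.cong (x ^_) (m≡m%n+[m/n]*n k n) ⟨
        x ^ k                            ≈⟨ xᵏ≈ε ⟩
        ε                                ∎

  IsOrder-unique : ∀ {x m n} → IsOrder G x m → IsOrder G x n → m ≡ n
  IsOrder-unique oₘ oₙ = ∣-antisym (IsOrder-^≈ε⇒∣ oₘ (IsOrder-∣⇒^≈ε oₙ ∣-refl))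
                                  (IsOrder-^≈ε⇒∣ oₙ (IsOrder-∣⇒^≈ε oₘ ∣-refl))

  IsOrder-resp-≈ : ∀ {x y n} → x ≈ y → IsOrder G x n → IsOrder G y n
  IsOrder-resp-≈ {n = n} x≈y (1≤n , xⁿ≈ε , least) =
    1≤n , trans (^-congˡ n (sym x≈y)) xⁿ≈ε ,
    λ j 1≤j j<n yʲ≈ε → least j 1≤j j<n (trans (^-congˡ j x≈y) yʲ≈ε)

  ε-order : IsOrder G ε 1
  ε-order = s≤s z≤n , identityʳ ε , λ { _ (s≤s _) (s≤s ()) _ }

  IsOrder-1⇒≈ε : ∀ {x} → IsOrder G x 1 → x ≈ ε
  IsOrder-1⇒≈ε {x} (_ , x¹≈ε , _) = trans (sym (identityʳ x)) x¹≈ε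

  ≉ε⇒order>1 : ∀ {x n} → ¬ x ≈ ε → IsOrder G x n → 1 < n
  ≉ε⇒order>1 {n = zero}        _   (() , _)
  ≉ε⇒order>1 {n = suc zero}    x≉ε o = ⊥-elim (x≉ε (IsOrder-1⇒≈ε o))
  ≉ε⇒order>1 {n = suc (suc n)} _   _ = s≤s (s≤s z≤n)

  IsOrder-^ : ∀ {x} q {d} → IsOrder G x (q * d) → 1 ≤ d → IsOrder G (x ^ q) d
  IsOrder-^ zero            (() , _)
  IsOrder-^ {x} q@(suc q′) {d} (_ , x^[q*d]≈ε , least) 1≤d =
    1≤d , trans (^-assoc x q d) x^[q*d]≈ε ,
    λ j 1≤j j<d x^[q*j]≈ε →
      least (q * j) (≤-trans 1≤j (m≤m+n j (q′ * j))) (*-monoʳ-< q j<d)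
            (trans (sym (^-assoc x q j)) x^[q*j]≈ε)

  IsOrder-∙-∣ : ∀ {x y p q r} → IsOrder G x p → IsOrder G y q →
                IsOrder G (x ∙ y) r → p ∣ r * q
  IsOrder-∙-∣ {x} {y} {q = q} {r} oₓ oᵧ oₓᵧ = IsOrder-^≈ε⇒∣ oₓ (begin
    x ^ (r * q)                  ≈⟨ identityʳ _ ⟨
    x ^ (r * q) ∙ ε              ≈⟨ ∙-congˡ (IsOrder-∣⇒^≈ε oᵧ (n∣m*n r)) ⟨
    x ^ (r * q) ∙ y ^ (r * q)    ≈⟨ ^-distrib-∙ x y (r * q) ⟨
    (x ∙ y) ^ (r * q)            ≈⟨ IsOrder-∣⇒^≈ε oₓᵧ (divides q (*-comm r q)) ⟩
    ε                            ∎)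

  ε-ODAdj : ∀ {x n} → ¬ x ≈ ε → IsOrder G x n → ODAdj G ε x
  ε-ODAdj x≉ε oₓ =
    x≉ε ∘ sym , 1 , _ , ε-order , oₓ , (λ 1≡n → <-irrefl 1≡n (≉ε⇒order>1 x≉ε oₓ)) , inj₁ (1∣ _)

  NonIdentityIndependent : Set (c ⊔ ℓ)
  NonIdentityIndependent = ∀ {u v} → ¬ u ≈ ε → ¬ v ≈ ε → ¬ ODAdj G u v

  exponent-prime⇒order≡ : ∀ {x n p} → Prime p → x ^ p ≈ ε → ¬ x ≈ ε → IsOrder G x n → n ≡ p
  exponent-prime⇒order≡ pp xᵖ≈ε x≉ε oₓ with prime⇒irreducible pp (IsOrder-^≈ε⇒∣ oₓ xᵖ≈ε)
  ... | inj₁ ≡.refl = ⊥-elim (x≉ε (IsOrder-1⇒≈ε oₓ))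
  ... | inj₂ n≡p    = n≡p

  elementary⇒independent : IsElementaryAbelian G → NonIdentityIndependent
  elementary⇒independent (p , pp , exponent) u≉ε v≉ε (_ , _ , _ , oᵤ , oᵥ , m≢n , _) =
    m≢n (≡.trans (exponent-prime⇒order≡ pp (exponent _) u≉ε oᵤ)
                 (≡.sym (exponent-prime⇒order≡ pp (exponent _) v≉ε oᵥ)))

  independent⇒prime-order : NonIdentityIndependent → ∀ {x n} → ¬ x ≈ ε → IsOrder G x n → Prime n
  independent⇒prime-order indep {x} {n} x≉ε oₓ =
    prime {{n>1⇒nonTrivial (≉ε⇒order>1 x≉ε oₓ)}} ¬composite
    where
      ¬composite : ¬ Composite n
      ¬composite (hasNonTrivialDivisor {d} d<n d∣n@(divides q n≡q*d)) =
        indep x≉ε x^q≉ε (x≉x^q , n , d , oₓ , o[x^q] , (λ n≡d → <-irrefl (≡.sym n≡d) d<n) , inj₂ d∣n)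
        where
          o[x^q] : IsOrder G (x ^ q) d
          o[x^q] = IsOrder-^ q (≡.subst (IsOrder G x) n≡q*d oₓ) (<⇒≤ (nonTrivial⇒n>1 d))
          x^q≉ε : ¬ x ^ q ≈ ε
          x^q≉ε x^q≈ε = <-irrefl (IsOrder-unique (IsOrder-resp-≈ (sym x^q≈ε) ε-order) o[x^q]) (nonTrivial⇒n>1 d)
          x≉x^q : ¬ x ≈ x ^ q
          x≉x^q x≈x^q = <-irrefl (IsOrder-unique o[x^q] (IsOrder-resp-≈ x≈x^q oₓ)) d<n

  module _ (finite : Finite G) where
    open Finite finite

    to-injective : ∀ {x y} → to x ≡ to y → x ≈ y
    to-injective {x} {y} tx≡ty = trans (sym (from-to x)) (trans (reflexive (≡.cong from tx≡ty)) (from-to y))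

    ≈-dec : ∀ x y → Dec (x ≈ y)
    ≈-dec x y = map′ to-injective to-cong (to x ≟ᶠ to y)

    ^-periodic : ∀ x → ∃ λ k → 1 ≤ k × x ^ k ≈ ε
    ^-periodic x with pigeonhole (n<1+n size) (λ i → to (x ^ toℕ i))
    ... | i , j , i<j , same = toℕ j ∸ toℕ i , m<n⇒0<n∸m i<j , identityˡ-unique _ _ (begin
      x ^ (toℕ j ∸ toℕ i) ∙ x ^ toℕ i     ≈⟨ ^-homo-+ x (toℕ j ∸ toℕ i) (toℕ i) ⟨
      x ^ (toℕ j ∸ toℕ i + toℕ i) ≡⟨ ≡.cong (x ^_) (m∸n+n≡m (<⇒≤ i<j)) ⟩
      x ^ toℕ j                            ≈⟨ to-injective same ⟨
      x ^ toℕ i                            ∎)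

    order : ∀ x → ∃ (IsOrder G x)
    order x with ^-periodic x
    ... | _ , positive , periodic with least-witness (λ j → (1 ≤? j) ×-dec ≈-dec (x ^ j) ε) (positive , periodic)
    ... | n , (1≤n , xⁿ≈ε) , least = n , 1≤n , xⁿ≈ε , λ j 1≤j j<n xʲ≈ε → least j<n (1≤j , xʲ≈ε)

    order-trivial-or-prime : NonIdentityIndependent → ∀ {x n} → IsOrder G x n → n ≡ 1 ⊎ Prime n
    order-trivial-or-prime indep {x} oₓ with ≈-dec x ε
    ... | yes x≈ε = inj₁ (IsOrder-unique oₓ (IsOrder-resp-≈ (sym x≈ε) ε-order))
    ... | no x≉ε  = inj₂ (independent⇒prime-order indep x≉ε oₓ)

    star⇒independent : ODIsStar G → NonIdentityIndependent
    star⇒independent (z , _ , edges) {u} {v} u≉ε v≉ε adj with ≈-dec z ε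
    ... | yes z≈ε with edges u v adj
    ...   | inj₁ u≈z = u≉ε (trans u≈z z≈ε)
    ...   | inj₂ v≈z = v≉ε (trans v≈z z≈ε)
    star⇒independent (z , _ , edges) {u} {v} u≉ε v≉ε adj | no z≉ε =
      proj₁ adj (trans (≈z u≉ε) (sym (≈z v≉ε)))
      where
        ≈z : ∀ {x} → ¬ x ≈ ε → x ≈ z
        ≈z {x} x≉ε with edges ε x (ε-ODAdj x≉ε (proj₂ (order x)))
        ... | inj₁ ε≈z = ⊥-elim (z≉ε (sym ε≈z))
        ... | inj₂ x≈z = x≈z

    independent⇒star : NonIdentityIndependent → ODIsStar G
    independent⇒star indep = ε , (λ v v≉ε → ε-ODAdj v≉ε (proj₂ (order v))) , edges-at-ε
      where
        edges-at-ε : ∀ u v → ODAdj G u v → u ≈ ε ⊎ v ≈ ε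
        edges-at-ε u v adj with ≈-dec u ε | ≈-dec v ε
        ... | yes u≈ε | _       = inj₁ u≈ε
        ... | no _    | yes v≈ε = inj₂ v≈ε
        ... | no u≉ε  | no v≉ε  = ⊥-elim (indep u≉ε v≉ε adj)

    independent⇒elementary : NonIdentityIndependent → IsElementaryAbelian G
    independent⇒elementary indep with all? (λ i → ≈-dec (from i) ε)
    ... | yes all≈ε = 2 , prime[2] , λ y →
      IsOrder-∣⇒^≈ε (IsOrder-resp-≈ (trans (sym (all≈ε (to y))) (from-to y)) ε-order) (1∣ 2)
    ... | no ¬all≈ε with ¬∀⟶∃¬ size _ (λ i → ≈-dec (from i) ε) ¬all≈ε
    ... | i , x≉ε with order (from i)
    ... | p , oₓ = p , pp , exponent
      where
        pp = independent⇒prime-order indep x≉ε oₓ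
        exponent : ∀ y → y ^ p ≈ ε
        exponent y with order y | order (from i ∙ y)
        ... | q , oᵧ | r , oₓᵧ with order-trivial-or-prime indep oᵧ
        ...   | inj₁ ≡.refl = IsOrder-∣⇒^≈ε oᵧ (1∣ p)
        ...   | inj₂ pq     = IsOrder-∣⇒^≈ε oᵧ (≡.subst (_∣ p) p≡q ∣-refl)
          where
            p≡q : p ≡ q
            p≡q = p∣r*q∧q∣r*p⇒p≡q pp pq (order-trivial-or-prime indep oₓᵧ)
                    (IsOrder-∙-∣ oₓ oᵧ oₓᵧ) (IsOrder-∙-∣ oᵧ oₓ (IsOrder-resp-≈ (comm _ _) oₓᵧ))

corollary1 : ∀ {c ℓ : Level} (G : AbelianGroup c ℓ) → Finite G →
    ODIsStar G ⇔ IsElementaryAbelian G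
corollary1 G finite =
  mk⇔ (independent⇒elementary G finite ∘ star⇒independent G finite)
      (independent⇒star G finite ∘ elementary⇒independent G)
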